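{- Let $S=(\alpha_1,\dots,\alpha_n)$ be a list of positive integers with $\alpha_1\le\alpha_2\le\cdots\le\alpha_n$, let $M=\sum_j\alpha_j$, and let $X$ be the random variable on $\mathcal{X}=\{1,\dots,n\}$ with $\mathbb{P}[X=j]=\alpha_j/M$. Let $k<n$ and $\mathcal{A}=\{1,\dots,k\}$. For a map $f:\mathcal{X}\to\mathcal{A}$ with $A=f(X)$, define $$L(X|A)=\sum_{i:\,\mathbb{P}[A=i]>0}\mathbb{P}[A=i]\,\mathbb{E}[\ell_i(X)\mid A=i],$$ where $\ell_i(x)$ is the length of the codeword assigned to $x$ by a binary Huffman code $\mathcal{C}_i$ for the conditional distribution of $X$ given $A=i$. Then there exists a map $f:\mathcal{X}\to\mathcal{A}$ minimizing $L(X|A)$ over all maps $\mathcal{X}\to\mathcal{A}$ such that $f(1)=f(2)$.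
   Context: A binary Huffman code for a distribution is a binary prefix-free code of minimum expected codeword length; its expected length is therefore the minimum expected length over all binary prefix-free codes for that distribution (so $L(X|A)$ does not depend on the choice of Huffman code). For a distribution concentrated on a single symbol the Huffman code assigns the empty codeword, of length $0$. -}

module Defs where

open import Data.Nat using (ℕ; zero; suc; _+_; _*_; _∸_; _≤_; _<_)
open import Data.Fin using (Fin; toℕ; _≟_)
open import Data.List using (List; length; tabulate; _++_)
open import Data.Nat.ListAction using (sum)
open import Data.Bool using (Bool; if_then_else_)
open import Data.Product using (Σ; ∃; _×_)
open import Data.Integer using (+_)
open import Data.Rational.Unnormalised using (ℚᵘ; mkℚᵘ)
open import Relation.Nullary using (¬_; ⌊_⌋)
open import Relation.Binary.PropositionalEquality using (_≡_; _≢_)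

ΣFin : (n : ℕ) → (Fin n → ℕ) → ℕ
ΣFin n g = sum (tabulate g)

_IsPrefixOf_ : List Bool → List Bool → Set
u IsPrefixOf v = ∃ λ w → u ++ w ≡ v

-- A binary code c for the symbols of class i of f (i.e. the support
-- {x | f x = i} of the conditional distribution of X given A = i)
-- is prefix-free: no codeword of a class member is a prefix of the
-- codeword of a different class member.
PrefixFreeOn : {n k : ℕ} → (f : Fin n → Fin k) → Fin k → (Fin n → List Bool) → Set
PrefixFreeOn {n} f i c =
  (x y : Fin n) → f x ≡ i → f y ≡ i → x ≢ y → ¬ (c x IsPrefixOf c y)

-- Weighted length of code c on class i:  Σ_{x : f x = i} α x * |c x|
-- ( = M_i · E[ℓ_i(X) | A = i], where M_i = Σ_{f x = i} α x )
classCost : {n k : ℕ} → (Fin n → ℕ) → (Fin n → Fin k) → Fin k → (Fin n → List Bool) → ℕ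
classCost {n} α f i c =
  ΣFin n (λ x → if ⌊ f x ≟ i ⌋ then α x * length (c x) else 0)

-- m is the minimum weighted length over binary prefix-free codes for class i,
-- i.e. the weighted length of a binary Huffman code for the conditional
-- distribution of X given A = i.
IsHuffmanCost : {n k : ℕ} → (Fin n → ℕ) → (Fin n → Fin k) → Fin k → ℕ → Set
IsHuffmanCost α f i m =
  (∃ λ c → PrefixFreeOn f i c × classCost α f i c ≡ m)
  × (∀ c → PrefixFreeOn f i c → m ≤ classCost α f i c)

total : {n : ℕ} → (Fin n → ℕ) → ℕ
total {n} α = ΣFin n α

-- Rational (numerator / M); M ≥ 1 in all uses, so mkℚᵘ num (M ∸ 1) = num / M.
_/M_ : ℕ → ℕ → ℚᵘ
num /M M = mkℚᵘ (+ num) (M ∸ 1)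

-- v is the value of L(X|A) for A = f(X):
--   L(X|A) = Σ_i P[A=i] E[ℓ_i(X)|A=i] = (Σ_i m_i) / M,
-- with m_i the Huffman (optimal) weighted length of class i.
IsCondLength : {n k : ℕ} → (Fin n → ℕ) → (Fin n → Fin k) → ℚᵘ → Set
IsCondLength {n} {k} α f v =
  Σ (Fin k → ℕ) λ m → (∀ i → IsHuffmanCost α f i (m i)) × v ≡ (ΣFin k m /M total α)

-- L(X|A) is 1/M times the sum over the classes of f of their optimal weighted code lengths,
-- so minimising it over f amounts to minimising the total weighted length Σ α x · |c x| over
-- pairs (f, c) with c prefix-free on every class of f. A minimising pair exists since, α being
-- positive, only finitely many pairs have cost below a given bound. It is then normalised by the
-- exchange arguments behind the optimality of Huffman codes: every nonempty codeword of an optimal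
-- code has a class-mate codeword at least as long (else dropping its last bit would be cheaper),
-- and swapping two symbols so that the lighter one gets the shorter codeword never costs more.
-- Make the codeword of 0F nonempty (pigeonhole, as k < n) and at least as long as that of 1F;
-- swapping 1F with a long class-mate of 0F then puts 0F and 1F (the paper's 1 and 2) together.
module Submission where

open import Defs
open import Data.Nat using (ℕ; _≤_; _<_)
open import Data.Fin using (Fin; toℕ)
open import Data.Product using (Σ; ∃; _×_)
open import Data.Rational.Unnormalised using (ℚᵘ)
open import Relation.Binary.PropositionalEquality using (_≡_)
import Data.Rational.Unnormalised as Q

open import Algebra.Properties.CommutativeSemigroup using (xy∙z≈zy∙x; xy∙z≈xz∙y)
open import Data.Bool using (Bool; true; false; if_then_else_)
import Data.Bool.Properties as Bool
open import Data.Empty using (⊥-elim)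
open import Data.Fin using (zero; suc; punchIn; fromℕ<; _≟_)
open import Data.Fin.Patterns using (0F; 1F)
open import Data.Fin.Permutation.Components using (transpose; transpose-inverse)
open import Data.Fin.Properties
  using (punchInᵢ≢i; any?; all?; pigeonhole; toℕ-injective; toℕ<n; toℕ-fromℕ<) renaming (<⇒≢ to <⇒≢ᶠ)
import Data.Integer as ℤ
import Data.Integer.Properties as ℤ
open import Data.List using (List; []; _∷_; length; replicate; _++_; _∷ʳ_; initLast; _∷ʳ′_)
open import Data.List.Properties using (∷-injectiveˡ; ∷-injectiveʳ; length-++; ++-assoc)
open import Data.Nat using (zero; suc; _+_; _*_; _∸_; z≤n; s≤s; _≤?_)
open import Data.Nat.Induction using (<-rec)
open import Data.Nat.Properties
  using (+-0-commutativeMonoid; +-commutativeSemigroup; +-comm; +-assoc; *-suc; *-identityˡ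
        ; m≤m+n; m<m+n; ≤-trans; ≤-reflexive; ≤-total; ≮⇒≥; <⇒≱; +-monoʳ-≤; +-monoˡ-≤; *-monoˡ-≤
        ; +-cancelʳ-≤; +-cancelˡ-≤; +-cancelʳ-≡; m≤n⇒∃[o]m+o≡n; module ≤-Reasoning)
open import Data.Nat.Tactic.RingSolver using (solve-∀)
open import Data.Product using (∃₂; _,_; proj₁; proj₂)
open import Data.Sum using (inj₁; inj₂)
open import Data.Vec using (Vec; []; _∷_; lookup; tabulate)
open import Data.Vec.Functional using (updateAt)
open import Data.Vec.Functional.Properties using (updateAt-updates; updateAt-minimal)
open import Data.Vec.Properties using (lookup∘tabulate)
open import Function using (_∘_; const; case_of_)
open import Level using (0ℓ)
open import Relation.Binary.PropositionalEquality
  using (_≢_; _≗_; refl; sym; trans; cong; cong₂; subst; subst₂; module ≡-Reasoning)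
open import Relation.Nullary using (¬_; Dec; yes; no; ⌊_⌋)
open import Relation.Nullary.Decidable using (map′; _×-dec_; _⊎-dec_; _→-dec_; ¬?; dec-true; dec-false)
open import Relation.Unary using (Pred; Decidable)
open import Algebra.Properties.CommutativeMonoid.Sum +-0-commutativeMonoid
  using (sum-remove; sum-cong-≗; sum-replicate-zero; ∑-comm) renaming (sum to ∑)

ΣFin≡∑ : ∀ {n} (f : Fin n → ℕ) → ΣFin n f ≡ ∑ f
ΣFin≡∑ {zero}  f = refl
ΣFin≡∑ {suc n} f = cong (f zero +_) (ΣFin≡∑ (f ∘ suc))

∑-update : ∀ {n} {f h : Fin n → ℕ} (a : Fin n) → (∀ y → y ≢ a → f y ≡ h y) →
  ∑ f + h a ≡ ∑ h + f a
∑-update {suc n} {f} {h} a f≡h = begin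
  ∑ f + h a                      ≡⟨ cong (_+ h a) (sum-remove {i = a} f) ⟩
  f a + ∑ (f ∘ punchIn a) + h a  ≡⟨ cong (λ s → f a + s + h a) (sum-cong-≗ λ y → f≡h _ (punchInᵢ≢i a y)) ⟩
  f a + ∑ (h ∘ punchIn a) + h a  ≡⟨ xy∙z≈zy∙x +-commutativeSemigroup (f a) _ (h a) ⟩
  h a + ∑ (h ∘ punchIn a) + f a  ≡⟨ cong (_+ f a) (sum-remove {i = a} h) ⟨
  ∑ h + f a                      ∎
  where open ≡-Reasoning

-- Pass through g, which agrees with h at a and with f everywhere else.
∑-update₂ : ∀ {n} {f h : Fin n → ℕ} (a b : Fin n) → a ≢ b → (∀ y → y ≢ a → y ≢ b → f y ≡ h y) →
  ∑ f + (h a + h b) ≡ ∑ h + (f a + f b)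
∑-update₂ {f = f} {h} a b a≢b f≡h = begin
  ∑ f + (h a + h b)  ≡⟨ +-assoc (∑ f) (h a) (h b) ⟨
  ∑ f + h a + h b    ≡⟨ cong (λ t → ∑ f + t + h b) (updateAt-updates a f) ⟨
  ∑ f + g a + h b    ≡⟨ cong (_+ h b) (∑-update {f = f} {g} a f≡g) ⟩
  ∑ g + f a + h b    ≡⟨ xy∙z≈xz∙y +-commutativeSemigroup (∑ g) (f a) (h b) ⟩
  ∑ g + h b + f a    ≡⟨ cong (_+ f a) (∑-update {f = g} {h} b g≡h) ⟩
  ∑ h + g b + f a    ≡⟨ cong (λ t → ∑ h + t + f a) (updateAt-minimal b a f (a≢b ∘ sym)) ⟩
  ∑ h + f b + f a    ≡⟨ xy∙z≈zy∙x +-commutativeSemigroup (∑ h) (f b) (f a) ⟩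
  f a + f b + ∑ h    ≡⟨ +-comm (f a + f b) (∑ h) ⟩
  ∑ h + (f a + f b)  ∎
  where
  open ≡-Reasoning
  g : Fin _ → ℕ
  g = updateAt f a (const (h a))
  f≡g : ∀ y → y ≢ a → f y ≡ g y
  f≡g y y≢a = sym (updateAt-minimal y a f y≢a)
  g≡h : ∀ y → y ≢ b → g y ≡ h y
  g≡h y y≢b with y ≟ a
  ... | yes refl = updateAt-updates a f
  ... | no y≢a   = trans (updateAt-minimal y a f y≢a) (f≡h y y≢a y≢b)

∑-indicator : ∀ {k} (a : Fin k) (v : ℕ) → ∑ (λ j → if ⌊ a ≟ j ⌋ then v else 0) ≡ v
∑-indicator {suc k} a v = begin
  ∑ δ                    ≡⟨ sum-remove {i = a} δ ⟩
  δ a + ∑ (δ ∘ punchIn a) ≡⟨ cong₂ _+_ (if-yes refl) (sum-cong-≗ λ j → if-no {punchIn a j} (punchInᵢ≢i a j ∘ sym)) ⟩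
  v + ∑ {k} (λ _ → 0)     ≡⟨ cong (v +_) (sum-replicate-zero k) ⟩
  v + 0                   ≡⟨ +-comm v 0 ⟩
  v                       ∎
  where
  open ≡-Reasoning
  δ : Fin (suc k) → ℕ
  δ j = if ⌊ a ≟ j ⌋ then v else 0
  if-yes : ∀ {j} → a ≡ j → δ j ≡ v
  if-yes {j} a≡j with a ≟ j
  ... | yes _   = refl
  ... | no a≢j = ⊥-elim (a≢j a≡j)
  if-no : ∀ {j} → a ≢ j → δ j ≡ 0
  if-no {j} a≢j with a ≟ j
  ... | yes a≡j = ⊥-elim (a≢j a≡j)
  ... | no _    = refl

≤-∑ : ∀ {n} (f : Fin n → ℕ) (a : Fin n) → f a ≤ ∑ f
≤-∑ {suc n} f a = ≤-trans (m≤m+n (f a) _) (≤-reflexive (sym (sum-remove {i = a} f)))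

prefix? : (u v : List Bool) → Dec (u IsPrefixOf v)
prefix? []      v       = yes (v , refl)
prefix? (a ∷ u) []      = no λ ()
prefix? (a ∷ u) (b ∷ v) with a Bool.≟ b | prefix? u v
... | no a≢b     | _            = no λ (w , eq) → a≢b (∷-injectiveˡ eq)
... | yes refl   | yes (w , eq) = yes (w , cong (a ∷_) eq)
... | yes refl   | no u⋢v       = no λ (w , eq) → u⋢v (w , ∷-injectiveʳ eq)

Code : ℕ → Set
Code n = Fin n → List Bool

PrefixFree : ∀ {n k} → (Fin n → Fin k) → Code n → Set
PrefixFree g c = ∀ i → PrefixFreeOn g i c

cost : ∀ {n} → (Fin n → ℕ) → Code n → ℕ
cost α c = ∑ λ x → α x * length (c x)

IsOptimal : ∀ {n k} → (Fin n → ℕ) → (Fin n → Fin k) → Code n → Set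
IsOptimal {n} {k} α g c = PrefixFree g c × (∀ (g′ : Fin n → Fin k) c′ → PrefixFree g′ c′ → cost α c ≤ cost α c′)

prefixFree? : ∀ {n k} (g : Fin n → Fin k) (c : Code n) → Dec (PrefixFree g c)
prefixFree? g c = all? λ i → all? λ x → all? λ y →
  (g x ≟ i) →-dec (g y ≟ i) →-dec ¬? (x ≟ y) →-dec ¬? (prefix? (c x) (c y))

PrefixFree-cong : ∀ {n k} {g g′ : Fin n → Fin k} {c c′ : Code n} →
  g ≗ g′ → c ≗ c′ → PrefixFree g c → PrefixFree g′ c′
PrefixFree-cong g≗g′ c≗c′ pf i x y gx gy x≢y =
  pf i x y (trans (g≗g′ x) gx) (trans (g≗g′ y) gy) x≢y ∘ subst₂ _IsPrefixOf_ (sym (c≗c′ x)) (sym (c≗c′ y))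

PrefixFree-∘ : ∀ {n k} {g : Fin n → Fin k} {c : Code n} (σ : Fin n → Fin n) →
  (∀ {x y} → σ x ≡ σ y → x ≡ y) → PrefixFree g c → PrefixFree (g ∘ σ) (c ∘ σ)
PrefixFree-∘ σ σ-injective pf i x y gx gy x≢y = pf i (σ x) (σ y) gx gy (x≢y ∘ σ-injective)

PrefixFree⇒nonempty : ∀ {n k} {g : Fin n → Fin k} {c : Code n} → PrefixFree g c →
  ∀ {x y} → x ≢ y → g x ≡ g y → 1 ≤ length (c x)
PrefixFree⇒nonempty {c = c} pf {x} {y} x≢y gx≡gy with c x in cx
... | []    = ⊥-elim (pf _ x y gx≡gy refl x≢y (subst (_IsPrefixOf c y) (sym cx) (c y , refl)))
... | _ ∷ _ = s≤s z≤n

unary : ∀ {n} → Code n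
unary x = replicate (toℕ x) true ++ false ∷ []

unary-prefixFree : ∀ {n k} (g : Fin n → Fin k) → PrefixFree g unary
unary-prefixFree g i x y _ _ x≢y u⊑v = x≢y (toℕ-injective (unary-injective (toℕ x) (toℕ y) u⊑v))
  where
  unary-injective : ∀ a b → (replicate a true ++ false ∷ []) IsPrefixOf (replicate b true ++ false ∷ []) → a ≡ b
  unary-injective zero    zero    _        = refl
  unary-injective (suc a) (suc b) (w , eq) = cong suc (unary-injective a b (w , ∷-injectiveʳ eq))

classCost-cong : ∀ {n k} (α : Fin n → ℕ) (g : Fin n → Fin k) (i : Fin k) {c d : Code n} →
  (∀ x → g x ≡ i → c x ≡ d x) → classCost α g i c ≡ classCost α g i d
classCost-cong α g i {c} {d} c≡d = begin
  classCost α g i c  ≡⟨ ΣFin≡∑ (term c) ⟩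
  ∑ (term c)         ≡⟨ sum-cong-≗ term-cong ⟩
  ∑ (term d)         ≡⟨ ΣFin≡∑ (term d) ⟨
  classCost α g i d  ∎
  where
  open ≡-Reasoning
  term : Code _ → Fin _ → ℕ
  term e x = if ⌊ g x ≟ i ⌋ then α x * length (e x) else 0
  term-cong : ∀ x → term c x ≡ term d x
  term-cong x with g x ≟ i
  ... | yes gx≡i = cong (λ w → α x * length w) (c≡d x gx≡i)
  ... | no _     = refl

cost≡∑classCost : ∀ {n k} (α : Fin n → ℕ) (g : Fin n → Fin k) (c : Code n) →
  cost α c ≡ ∑ λ i → classCost α g i c
cost≡∑classCost α g c = begin
  cost α c                         ≡⟨ sum-cong-≗ (λ x → ∑-indicator (g x) _) ⟨
  ∑ (λ x → ∑ λ i → term i x)       ≡⟨ ∑-comm (λ x i → term i x) ⟩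
  ∑ (λ i → ∑ λ x → term i x)       ≡⟨ sum-cong-≗ (λ i → ΣFin≡∑ (term i)) ⟨
  ∑ (λ i → classCost α g i c)      ∎
  where
  open ≡-Reasoning
  term : Fin _ → Fin _ → ℕ
  term i x = if ⌊ g x ≟ i ⌋ then α x * length (c x) else 0

length≤cost : ∀ {n} {α : Fin n → ℕ} → (∀ x → 1 ≤ α x) → (c : Code n) (x : Fin n) → length (c x) ≤ cost α c
length≤cost {α = α} α≥1 c x = begin
  length (c x)          ≡⟨ *-identityˡ _ ⟨
  1 * length (c x)      ≤⟨ *-monoˡ-≤ (length (c x)) (α≥1 x) ⟩
  α x * length (c x)    ≤⟨ ≤-∑ (λ y → α y * length (c y)) x ⟩
  cost α c              ∎
  where open ≤-Reasoning

Exhaustible : Set → Set₁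
Exhaustible A = ∀ {P : Pred A 0ℓ} → Decidable P → Dec (∃ P)

Vec-exhaustible : ∀ {A} → Exhaustible A → ∀ n → Exhaustible (Vec A n)
Vec-exhaustible search zero    P? = map′ ([] ,_) (λ { ([] , p) → p }) (P? [])
Vec-exhaustible search (suc n) P? =
  map′ (λ (a , v , p) → a ∷ v , p) (λ { (a ∷ v , p) → a , v , p })
       (search λ a → Vec-exhaustible search n (λ v → P? (a ∷ v)))

Word≤ : ℕ → Set
Word≤ m = Σ (List Bool) λ w → length w ≤ m

Word≤-exhaustible : ∀ m → Exhaustible (Word≤ m)
Word≤-exhaustible zero    P? = map′ (([] , z≤n) ,_) (λ { (([] , z≤n) , p) → p }) (P? ([] , z≤n))
Word≤-exhaustible (suc m) {P} P? =
  map′ (λ { (inj₁ p) → ([] , z≤n) , p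
          ; (inj₂ (inj₁ ((w , l) , p))) → (true ∷ w , s≤s l) , p
          ; (inj₂ (inj₂ ((w , l) , p))) → (false ∷ w , s≤s l) , p })
       (λ { (([] , z≤n) , p) → inj₁ p
          ; ((true ∷ w , s≤s l) , p) → inj₂ (inj₁ ((w , l) , p))
          ; ((false ∷ w , s≤s l) , p) → inj₂ (inj₂ ((w , l) , p)) })
       (P? ([] , z≤n) ⊎-dec extend true ⊎-dec extend false)
  where
  extend : ∀ b → Dec (∃ λ ((w , l) : Word≤ m) → P (b ∷ w , s≤s l))
  extend b = Word≤-exhaustible m λ (w , l) → P? (b ∷ w , s≤s l)

least-witness : ∀ {Q : Pred ℕ 0ℓ} → Decidable Q → ∀ {N} → Q N → ∃ λ m → Q m × (∀ {m′} → Q m′ → m ≤ m′)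
least-witness {Q} Q? {N} = <-rec (λ N → Q N → ∃ λ m → Q m × (∀ {m′} → Q m′ → m ≤ m′)) descend N
  where
  descend : ∀ N → (∀ {M} → M < N → Q M → ∃ λ m → Q m × (∀ {m′} → Q m′ → m ≤ m′)) →
    Q N → ∃ λ m → Q m × (∀ {m′} → Q m′ → m ≤ m′)
  descend N below qN with any? (λ (i : Fin N) → Q? (toℕ i))
  ... | yes (i , qi) = below (toℕ<n i) qi
  ... | no none      = N , qN , λ {m′} qm′ →
    ≮⇒≥ λ m′<N → none (fromℕ< m′<N , subst Q (sym (toℕ-fromℕ< m′<N)) qm′)

module _ {n k : ℕ} {α : Fin n → ℕ} (α≥1 : ∀ x → 1 ≤ α x) where

  -- As vectors over finite alphabets, the pairs of cost at most m can be searched exhaustively.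
  CostAtMost : ℕ → Set
  CostAtMost m = ∃₂ λ (vg : Vec (Fin k) n) (vc : Vec (Word≤ m) n) →
    PrefixFree (lookup vg) (proj₁ ∘ lookup vc) × cost α (proj₁ ∘ lookup vc) ≤ m

  costAtMost? : Decidable CostAtMost
  costAtMost? m = Vec-exhaustible any? n λ vg → Vec-exhaustible (Word≤-exhaustible m) n λ vc →
    prefixFree? (lookup vg) (proj₁ ∘ lookup vc) ×-dec (cost α (proj₁ ∘ lookup vc) ≤? m)

  costAtMost-cost : ∀ g c → PrefixFree g c → CostAtMost (cost α c)
  costAtMost-cost g c pf = tabulate g , tabulate (λ x → c x , length≤cost α≥1 c x) ,
    PrefixFree-cong (sym ∘ lookup∘tabulate g) (sym ∘ word-lookup) pf ,
    ≤-reflexive (sum-cong-≗ λ x → cong (λ w → α x * length w) (word-lookup x))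
    where
    word-lookup : ∀ x → proj₁ (lookup (tabulate (λ y → c y , length≤cost α≥1 c y)) x) ≡ c x
    word-lookup x = cong proj₁ (lookup∘tabulate _ x)

  optimal-exists : Fin k → ∃₂ (IsOptimal α)
  optimal-exists i₀ with least-witness costAtMost? (costAtMost-cost (const i₀) unary (unary-prefixFree _))
  ... | _ , (vg , vc , pf , cost≤m) , least =
    lookup vg , proj₁ ∘ lookup vc , pf , λ g′ c′ pf′ → ≤-trans cost≤m (least (costAtMost-cost g′ c′ pf′))

transpose-matchˡ : ∀ {n} (a b : Fin n) → transpose a b a ≡ b
transpose-matchˡ a b rewrite dec-true (a ≟ a) refl = refl

transpose-matchʳ : ∀ {n} (a b : Fin n) → transpose a b b ≡ a
transpose-matchʳ a b with b ≟ a
... | yes b≡a = b≡a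
... | no _ rewrite dec-true (b ≟ b) refl = refl

transpose-other : ∀ {n} {a b y : Fin n} → y ≢ a → y ≢ b → transpose a b y ≡ y
transpose-other {a = a} {b} {y} y≢a y≢b rewrite dec-false (y ≟ a) y≢a | dec-false (y ≟ b) y≢b = refl

transpose-injective : ∀ {n} (a b : Fin n) {x y} → transpose a b x ≡ transpose a b y → x ≡ y
transpose-injective a b {x} {y} eq =
  trans (sym (transpose-inverse b a)) (trans (cong (transpose b a) eq) (transpose-inverse b a))

rearrangement : ∀ {a b d e} → a ≤ b → d ≤ e → a * e + b * d ≤ a * d + b * e
rearrangement {a} {d = d} a≤b d≤e with m≤n⇒∃[o]m+o≡n a≤b | m≤n⇒∃[o]m+o≡n d≤e
... | p , refl | q , refl = ≤-trans (m≤m+n _ (p * q)) (≤-reflexive (identity a p d q))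
  where
  identity : ∀ a p d q → a * (d + q) + (a + p) * d + p * q ≡ a * d + (a + p) * (d + q)
  identity = solve-∀

transpose-optimal : ∀ {n k} {α : Fin n → ℕ} {g : Fin n → Fin k} {c : Code n} {a b : Fin n} →
  a ≢ b → α a ≤ α b → length (c a) ≤ length (c b) →
  IsOptimal α g c → IsOptimal α (g ∘ transpose a b) (c ∘ transpose a b)
transpose-optimal {α = α} {g} {c} {a} {b} a≢b αa≤αb ca≤cb (pf , minimal) =
  PrefixFree-∘ (transpose a b) (transpose-injective a b) pf ,
  λ g′ c′ pf′ → ≤-trans swapped-cost≤ (minimal g′ c′ pf′)
  where
  f h : Fin _ → ℕ
  f y = α y * length (c y)
  h y = α y * length (c (transpose a b y))
  swapped≤ : h a + h b ≤ f a + f b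
  swapped≤ rewrite transpose-matchˡ a b | transpose-matchʳ a b = rearrangement αa≤αb ca≤cb
  f≡h : ∀ y → y ≢ a → y ≢ b → f y ≡ h y
  f≡h y y≢a y≢b = cong (λ t → α y * length (c t)) (sym (transpose-other y≢a y≢b))
  swapped-cost≤ : cost α (c ∘ transpose a b) ≤ cost α c
  swapped-cost≤ = +-cancelʳ-≤ (f a + f b) _ _ (begin
    ∑ h + (f a + f b)  ≡⟨ ∑-update₂ a b a≢b f≡h ⟨
    ∑ f + (h a + h b)  ≤⟨ +-monoʳ-≤ (∑ f) swapped≤ ⟩
    ∑ f + (f a + f b)  ∎)
    where open ≤-Reasoning

IsPrefixOf-++ : ∀ {u v : List Bool} (r : List Bool) → u IsPrefixOf v → u IsPrefixOf (v ++ r)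
IsPrefixOf-++ {u} r (w , refl) = w ++ r , sym (++-assoc u w r)

length-∷ʳ : ∀ (p : List Bool) b → length (p ∷ʳ b) ≡ suc (length p)
length-∷ʳ p b = trans (length-++ p) (+-comm (length p) 1)

split-last : ∀ (l : List Bool) → 1 ≤ length l → ∃₂ λ p b → l ≡ p ∷ʳ b
split-last l 1≤l with initLast l
split-last .[] () | []
... | p ∷ʳ′ b = p , b , refl

longer-than-parent : ∀ {p v : List Bool} {b} → p IsPrefixOf v → ¬ (v IsPrefixOf (p ∷ʳ b)) →
  length (p ∷ʳ b) ≤ length v
longer-than-parent {p} {b = b} ([] , refl) v⋢pb = ⊥-elim (v⋢pb (b ∷ [] , ++-assoc p [] (b ∷ [])))
longer-than-parent {p} {b = b} (r ∷ rs , refl) _ = begin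
  length (p ∷ʳ b)         ≡⟨ length-++ p ⟩
  length p + 1            ≤⟨ +-monoʳ-≤ (length p) (s≤s z≤n) ⟩
  length p + length (r ∷ rs) ≡⟨ length-++ p ⟨
  length (p ++ r ∷ rs)    ∎
  where open ≤-Reasoning

cost-updateAt : ∀ {n} (α : Fin n → ℕ) (c : Code n) (x : Fin n) (w : List Bool) →
  cost α (updateAt c x (const w)) + α x * length (c x) ≡ cost α c + α x * length w
cost-updateAt α c x w =
  trans (∑-update x (λ y y≢x → cong (λ l → α y * length l) (updateAt-minimal y x c y≢x)))
        (cong (λ l → cost α c + α x * length l) (updateAt-updates x c))

truncation-cost : ∀ {n} (α : Fin n → ℕ) {c : Code n} {x p b} → c x ≡ p ∷ʳ b →
  cost α (updateAt c x (const p)) + α x ≡ cost α c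
truncation-cost {n} α {c} {x} {p} {b} cx≡pb = +-cancelʳ-≡ (α x * length p) _ _ (begin
  cost α c′ + α x + α x * length p     ≡⟨ +-assoc (cost α c′) (α x) _ ⟩
  cost α c′ + (α x + α x * length p)   ≡⟨ cong (cost α c′ +_) (*-suc (α x) (length p)) ⟨
  cost α c′ + α x * suc (length p)     ≡⟨ cong (λ l → cost α c′ + α x * l) (trans (sym (length-∷ʳ p b)) (cong length (sym cx≡pb))) ⟩
  cost α c′ + α x * length (c x)       ≡⟨ cost-updateAt α c x p ⟩
  cost α c + α x * length p            ∎)
  where
  open ≡-Reasoning
  c′ : Code n
  c′ = updateAt c x (const p)

truncation-prefixFree : ∀ {n k} {g : Fin n → Fin k} {c : Code n} {x p b} → c x ≡ p ∷ʳ b →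
  PrefixFree g c → (∀ w → w ≢ x → g w ≡ g x → ¬ (p IsPrefixOf c w)) →
  PrefixFree g (updateAt c x (const p))
truncation-prefixFree {c = c} {x} {p} {b} cx≡pb pf no-sibling i y z gy gz y≢z with y ≟ x | z ≟ x
... | yes refl | yes refl = ⊥-elim (y≢z refl)
... | yes refl | no z≢x =
  no-sibling z z≢x (trans gz (sym gy)) ∘ subst₂ _IsPrefixOf_ (updateAt-updates x c) (updateAt-minimal z x c z≢x)
... | no y≢x | yes refl =
  pf i y x gy gz y≢z ∘ subst (c y IsPrefixOf_) (sym cx≡pb) ∘ IsPrefixOf-++ (b ∷ [])
    ∘ subst₂ _IsPrefixOf_ (updateAt-minimal y x c y≢x) (updateAt-updates x c)
... | no y≢x | no z≢x =
  pf i y z gy gz y≢z ∘ subst₂ _IsPrefixOf_ (updateAt-minimal y x c y≢x) (updateAt-minimal z x c z≢x)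

optimal-sibling : ∀ {n k} {α : Fin n → ℕ} {g : Fin n → Fin k} {c : Code n} → (∀ x → 1 ≤ α x) →
  IsOptimal α g c → ∀ x → 1 ≤ length (c x) → ∃ λ w → w ≢ x × g w ≡ g x × length (c x) ≤ length (c w)
optimal-sibling {α = α} {g} {c} α≥1 (pf , minimal) x 1≤cx with split-last (c x) 1≤cx
... | p , b , cx≡pb with any? (λ w → ¬? (w ≟ x) ×-dec (g w ≟ g x) ×-dec prefix? p (c w))
...   | yes (w , w≢x , gw≡gx , p⊑cw) =
  w , w≢x , gw≡gx , subst (λ l → length l ≤ length (c w)) (sym cx≡pb) (longer-than-parent p⊑cw cw⋢pb)
  where
  cw⋢pb : ¬ (c w IsPrefixOf (p ∷ʳ b))
  cw⋢pb = pf (g x) w x gw≡gx refl w≢x ∘ subst (c w IsPrefixOf_) (sym cx≡pb)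
...   | no no-sibling = ⊥-elim (<⇒≱ truncation-cheaper (minimal g _ truncated-prefixFree))
  where
  truncated-prefixFree : PrefixFree g (updateAt c x (const p))
  truncated-prefixFree = truncation-prefixFree {c = c} cx≡pb pf
    λ w w≢x gw≡gx p⊑cw → no-sibling (w , w≢x , gw≡gx , p⊑cw)
  truncation-cheaper : cost α (updateAt c x (const p)) < cost α c
  truncation-cheaper = subst (cost α (updateAt c x (const p)) <_) (truncation-cost α {c} cx≡pb)
                             (m<m+n (cost α (updateAt c x (const p))) (α≥1 x))

module _ {n k : ℕ} {α : Fin (suc (suc n)) → ℕ} (α≥1 : ∀ x → 1 ≤ α x)
         (α-mono : ∀ x y → toℕ x ≤ toℕ y → α x ≤ α y) where

  optimal-nonempty₀ : k < suc (suc n) → ∃₂ (IsOptimal α) →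
    ∃₂ λ (g : Fin _ → Fin k) c → IsOptimal α g c × 1 ≤ length (c 0F)
  optimal-nonempty₀ k<n (g , c , opt) with 1 ≤? length (c 0F)
  ... | yes 1≤c0 = g , c , opt , 1≤c0
  ... | no c0-empty with pigeonhole k<n g
  ...   | i , j , i<j , gi≡gj =
    g ∘ transpose 0F i , c ∘ transpose 0F i ,
    transpose-optimal {α = α} (i≢0 ∘ sym) (α-mono 0F i z≤n) (≤-trans (≮⇒≥ c0-empty) z≤n) opt ,
    subst (λ t → 1 ≤ length (c t)) (sym (transpose-matchˡ 0F i)) 1≤ci
    where
    1≤ci : 1 ≤ length (c i)
    1≤ci = PrefixFree⇒nonempty (proj₁ opt) (<⇒≢ᶠ i<j) gi≡gj
    i≢0 : i ≢ 0F
    i≢0 refl = c0-empty 1≤ci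

  optimal-longest₀ : ∃₂ (λ (g : Fin _ → Fin k) c → IsOptimal α g c × 1 ≤ length (c 0F)) →
    ∃₂ λ (g : Fin _ → Fin k) c → IsOptimal α g c × 1 ≤ length (c 0F) × length (c 1F) ≤ length (c 0F)
  optimal-longest₀ (g , c , opt , 1≤c0) with ≤-total (length (c 1F)) (length (c 0F))
  ... | inj₁ c1≤c0 = g , c , opt , 1≤c0 , c1≤c0
  ... | inj₂ c0≤c1 = g ∘ transpose 0F 1F , c ∘ transpose 0F 1F ,
    transpose-optimal {α = α} (λ ()) (α-mono 0F 1F z≤n) c0≤c1 opt , ≤-trans 1≤c0 c0≤c1 , c0≤c1

  optimal-merged : ∃₂ (λ (g : Fin _ → Fin k) c → IsOptimal α g c × 1 ≤ length (c 0F) × length (c 1F) ≤ length (c 0F)) →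
    ∃₂ λ (g : Fin _ → Fin k) c → IsOptimal α g c × g 0F ≡ g 1F
  optimal-merged (g , c , opt , 1≤c0 , c1≤c0) with optimal-sibling α≥1 opt 0F 1≤c0
  ... | w , w≢0 , gw≡g0 , c0≤cw with w ≟ 1F
  ...   | yes refl = g , c , opt , sym gw≡g0
  ...   | no w≢1 = g ∘ transpose 1F w , c ∘ transpose 1F w ,
    transpose-optimal {α = α} (w≢1 ∘ sym) (α₁≤ w w≢0 w≢1) (≤-trans c1≤c0 c0≤cw) opt , merged
    where
    α₁≤ : ∀ w → w ≢ 0F → w ≢ 1F → α 1F ≤ α w
    α₁≤ 0F            w≢0 _   = ⊥-elim (w≢0 refl)
    α₁≤ 1F            _   w≢1 = ⊥-elim (w≢1 refl)
    α₁≤ (suc (suc w)) _   _   = α-mono 1F _ (s≤s z≤n)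
    merged : g (transpose 1F w 0F) ≡ g (transpose 1F w 1F)
    merged = begin
      g (transpose 1F w 0F)  ≡⟨ cong g (transpose-other {a = 1F} (λ ()) (w≢0 ∘ sym)) ⟩
      g 0F                   ≡⟨ gw≡g0 ⟨
      g w                    ≡⟨ cong g (transpose-matchˡ 1F w) ⟨
      g (transpose 1F w 1F)  ∎
      where open ≡-Reasoning

/M-monoˡ-≤ : ∀ M {a b} → a ≤ b → (a /M M) Q.≤ (b /M M)
/M-monoˡ-≤ M a≤b = Q.*≤* (ℤ.*-monoʳ-≤-nonNeg (ℤ.+ suc (M ∸ 1)) (ℤ.+≤+ a≤b))

splice : ∀ {n k} → (Fin n → Fin k) → Fin k → Code n → Code n → Code n
splice f i d c x = if ⌊ f x ≟ i ⌋ then d x else c x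

module _ {n k : ℕ} {f : Fin n → Fin k} {i : Fin k} {d c : Code n} where

  splice-inside : ∀ {x} → f x ≡ i → splice f i d c x ≡ d x
  splice-inside {x} fx≡i with f x ≟ i
  ... | yes _    = refl
  ... | no fx≢i = ⊥-elim (fx≢i fx≡i)

  splice-outside : ∀ {x} → f x ≢ i → splice f i d c x ≡ c x
  splice-outside {x} fx≢i with f x ≟ i
  ... | yes fx≡i = ⊥-elim (fx≢i fx≡i)
  ... | no _     = refl

  splice-prefixFree : PrefixFreeOn f i d → PrefixFree f c → PrefixFree f (splice f i d c)
  splice-prefixFree pf-d pf j y z fy fz y≢z with f y ≟ i | f z ≟ i
  ... | yes fy≡i | yes fz≡i = pf-d y z fy≡i fz≡i y≢z
  ... | no fy≢i  | no fz≢i  = pf j y z fy fz y≢z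
  ... | yes fy≡i | no fz≢i  = ⊥-elim (fz≢i (trans fz (trans (sym fy) fy≡i)))
  ... | no fy≢i  | yes fz≡i = ⊥-elim (fy≢i (trans fy (trans (sym fz) fz≡i)))

  splice-cost : ∀ α → cost α (splice f i d c) + classCost α f i c ≡ cost α c + classCost α f i d
  splice-cost α = begin
    cost α e + classCost α f i c                    ≡⟨ cong (_+ classCost α f i c) (cost≡∑classCost α f e) ⟩
    ∑ (λ j → classCost α f j e) + classCost α f i c  ≡⟨ ∑-update i classCost-outside ⟩
    ∑ (λ j → classCost α f j c) + classCost α f i e  ≡⟨ cong₂ _+_ (cost≡∑classCost α f c) classCost-inside ⟨
    cost α c + classCost α f i d                    ∎
    where
    open ≡-Reasoning
    e : Code n
    e = splice f i d c
    classCost-outside : ∀ j → j ≢ i → classCost α f j e ≡ classCost α f j c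
    classCost-outside j j≢i = classCost-cong α f j λ x fx≡j → splice-outside (j≢i ∘ trans (sym fx≡j))
    classCost-inside : classCost α f i d ≡ classCost α f i e
    classCost-inside = classCost-cong α f i λ x fx≡i → sym (splice-inside fx≡i)

combine : ∀ {n k} → (Fin n → Fin k) → (Fin k → Code n) → Code n
combine g codes x = codes (g x) x

combine-prefixFree : ∀ {n k} (g : Fin n → Fin k) (codes : Fin k → Code n) →
  (∀ i → PrefixFreeOn g i (codes i)) → PrefixFree g (combine g codes)
combine-prefixFree g codes pf i x y gx gy x≢y =
  pf i x y gx gy x≢y ∘ subst₂ _IsPrefixOf_ (cong (λ j → codes j x) gx) (cong (λ j → codes j y) gy)

combine-classCost : ∀ {n k} (α : Fin n → ℕ) (g : Fin n → Fin k) (codes : Fin k → Code n) (i : Fin k) →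
  classCost α g i (combine g codes) ≡ classCost α g i (codes i)
combine-classCost α g codes i = classCost-cong α g i λ x gx≡i → cong (λ j → codes j x) gx≡i

module _ {n k : ℕ} {α : Fin n → ℕ} {f : Fin n → Fin k} {c : Code n} (opt : IsOptimal α f c) where

  optimal-IsHuffmanCost : ∀ i → IsHuffmanCost α f i (classCost α f i c)
  optimal-IsHuffmanCost i = (c , proj₁ opt i , refl) , λ d pf-d → +-cancelˡ-≤ (cost α c) _ _ (begin
    cost α c + classCost α f i c                   ≤⟨ +-monoˡ-≤ _ (proj₂ opt f _ (splice-prefixFree pf-d (proj₁ opt))) ⟩
    cost α (splice f i d c) + classCost α f i c    ≡⟨ splice-cost α ⟩
    cost α c + classCost α f i d                   ∎)
    where open ≤-Reasoning

  optimal-minimal : ∀ (g : Fin n → Fin k) Lg → IsCondLength α g Lg →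
    (ΣFin k (λ i → classCost α f i c) /M total α) Q.≤ Lg
  optimal-minimal g _ (m , huffman , refl) = /M-monoˡ-≤ (total α) (begin
    ΣFin k (λ i → classCost α f i c)  ≡⟨ ΣFin≡∑ (λ i → classCost α f i c) ⟩
    ∑ (λ i → classCost α f i c)       ≡⟨ cost≡∑classCost α f c ⟨
    cost α c                          ≤⟨ proj₂ opt g e (combine-prefixFree g codes (proj₁ ∘ proj₂ ∘ proj₁ ∘ huffman)) ⟩
    cost α e                          ≡⟨ cost≡∑classCost α g e ⟩
    ∑ (λ i → classCost α g i e)       ≡⟨ sum-cong-≗ (λ i → trans (combine-classCost α g codes i) (proj₂ (proj₂ (proj₁ (huffman i))))) ⟩
    ∑ m                               ≡⟨ ΣFin≡∑ m ⟨
    ΣFin k m                          ∎)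
    where
    open ≤-Reasoning
    codes : Fin k → Code n
    codes i = proj₁ (proj₁ (huffman i))
    e : Code n
    e = combine g codes

  optimal-minimises-L :
    Σ ℚᵘ λ Lf → IsCondLength α f Lf × (∀ (g : Fin n → Fin k) Lg → IsCondLength α g Lg → Lf Q.≤ Lg)
  optimal-minimises-L =
    ΣFin k (λ i → classCost α f i c) /M total α ,
    ((λ i → classCost α f i c) , optimal-IsHuffmanCost , refl) ,
    optimal-minimal

lemma2 : (n k : ℕ) → 1 ≤ k → k < n →
    (α : Fin n → ℕ) →
    (∀ j → 1 ≤ α j) →
    (∀ i j → toℕ i ≤ toℕ j → α i ≤ α j) →
    ∃ λ (f : Fin n → Fin k) →
    (∀ x y → toℕ x ≡ 0 → toℕ y ≡ 1 → f x ≡ f y)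
    × Σ ℚᵘ λ Lf → IsCondLength α f Lf
    × (∀ (g : Fin n → Fin k) (Lg : ℚᵘ) → IsCondLength α g Lg → Lf Q.≤ Lg)
lemma2 _             zero    () _
lemma2 zero          (suc _) _  ()
lemma2 (suc zero)    (suc _) _  (s≤s ())
lemma2 (suc (suc n)) (suc k) _  k<n α α≥1 α-mono =
  -- `with` here would make Agda normalise the exhaustive search behind optimal-exists.
  case optimal-merged α≥1 α-mono (optimal-longest₀ α≥1 α-mono
         (optimal-nonempty₀ α≥1 α-mono k<n (optimal-exists α≥1 zero))) of λ where
    (f , c , opt , f0≡f1) →
      f , (λ x y x≡0 y≡1 → begin
             f x   ≡⟨ cong f (toℕ-injective {j = 0F} x≡0) ⟩
             f 0F  ≡⟨ f0≡f1 ⟩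
             f 1F  ≡⟨ cong f (toℕ-injective {j = 1F} y≡1) ⟨
             f y   ∎) ,
        optimal-minimises-L {α = α} opt
  where open ≡-Reasoning
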